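{- In the setting described in the context, for every endpoint $w$ of an $M$-$M^*$-path, the number $c_w$ of transfers incident with $w$ satisfies $c_w\ge \min\{d_G(w)-1,\Delta-2\}\ge 1$.
   Context: Let $\Delta\ge 3$ and let $G=(V,E)$ be a finite simple graph with all degrees at most $\Delta$. A min-degree greedy algorithm proceeds in steps on a current graph (initially $G$): in each step, if the current graph has an edge, it chooses a node $u$ of minimum degree among the non-isolated nodes of the current graph, chooses any neighbor $v$ of $u$ in the current graph, adds $\{u,v\}$ to $M$ (initially empty), and deletes $u$, $v$ and all their incident edges; otherwise it stops. Let $M$ be the resulting matching; $d_G(x)$ is the degree of $x$ in $G$ and $d(x)$ its degree in the current graph at the time referred to. Fix a maximum matching $M^*$ such that every connected component $X$ of $(V,M\cup M^*)$ with at least one edge is either a single edge of $M\cap M^*$, or a path of $m_X\ge1$ edges of $M$ and $m_X+1$ edges of $M^*$ alternating, with first and last edge in $M^*$ (an $M$-$M^*$-path; its two end nodes are not covered by $M$). Let $F=E\setminus(M\cup M^*)$. An edge $\{v,w\}\in F$ with $v$ covered by $M$ and $w$ an endpoint of an $M$-$M^*$-path is a transfer if, where $s$ is the step in which $v$ is deleted, $d(w)\le \Delta-2$ holds at the end of step $s$. -}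

module Defs where

open import Data.Nat using (ℕ; zero; suc; _+_; _≤_; _∸_; _⊓_)
open import Data.Bool using (Bool; true; false; if_then_else_; _∧_; _∨_; not)
open import Data.Fin using (Fin; _≟_)
import Data.Fin as F
open import Data.List using (List; []; _∷_; _++_; length; head; last; concatMap)
open import Data.Bool.ListAction using (any)
open import Data.List.Membership.Propositional using (_∈_)
open import Data.List.Relation.Unary.All using (All)
open import Data.List.Relation.Unary.Unique.Propositional using (Unique)
open import Data.Maybe using (just)
open import Data.Product using (Σ; ∃; ∃-syntax; _×_; _,_)
open import Data.Sum using (_⊎_)
open import Relation.Nullary using (¬_)
open import Relation.Nullary.Decidable using (⌊_⌋)
open import Relation.Binary.PropositionalEquality using (_≡_)
open import Relation.Binary.Construct.Closure.ReflexiveTransitive using (Star)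

countB : ∀ {n} → (Fin n → Bool) → ℕ
countB {zero}  f = 0
countB {suc n} f = (if f F.zero then 1 else 0) + countB (λ i → f (F.suc i))

record Graph (n : ℕ) : Set where
  field
    adj   : Fin n → Fin n → Bool
    sym   : ∀ x y → adj x y ≡ adj y x
    irrefl : ∀ x → adj x x ≡ false
open Graph public

module _ {n : ℕ} (G : Graph n) where

  V : Set
  V = Fin n

  Adj : V → V → Set
  Adj x y = adj G x y ≡ true

  deg : V → ℕ
  deg x = countB (adj G x)

  inPairs : V → List (V × V) → Bool
  inPairs x ps = any (λ { (a , b) → ⌊ x ≟ a ⌋ ∨ ⌊ x ≟ b ⌋ }) ps

  -- degree of x in the current graph, i.e. G with all vertices of the
  -- pairs in ps deleted
  curdeg : List (V × V) → V → ℕ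
  curdeg ps x = countB (λ y → adj G x y ∧ not (inPairs y ps))

  -- Runs of the min-degree greedy algorithm, listed NEWEST STEP FIRST:
  -- (u , v) ∷ ps means: after the steps ps, the step choosing u (of minimum
  -- current degree among non-isolated nodes) and its neighbour v.
  data Run : List (V × V) → Set where
    done : Run []
    step : ∀ {ps u v} → Run ps →
           inPairs u ps ≡ false → inPairs v ps ≡ false → Adj u v →
           (∀ x → inPairs x ps ≡ false → 1 ≤ curdeg ps x →
                  curdeg ps u ≤ curdeg ps x) →
           Run ((u , v) ∷ ps)

  Greedy : List (V × V) → Set
  Greedy ps = Run ps ×
    (∀ x y → inPairs x ps ≡ false → inPairs y ps ≡ false → ¬ Adj x y)

  InE : V → V → List (V × V) → Set
  InE x y L = (x , y) ∈ L ⊎ (y , x) ∈ L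

  Covered : List (V × V) → V → Set
  Covered L x = ∃[ y ] InE x y L

  endpointsOf : List (V × V) → List V
  endpointsOf = concatMap (λ { (a , b) → a ∷ b ∷ [] })

  IsMatching : List (V × V) → Set
  IsMatching L = All (λ { (a , b) → Adj a b }) L × Unique (endpointsOf L)

  IsMaxMatching : List (V × V) → Set
  IsMaxMatching L = IsMatching L × (∀ L' → IsMatching L' → length L' ≤ length L)

  module _ (M Ms : List (V × V)) where

    HAdj : V → V → Set
    HAdj x y = InE x y M ⊎ InE x y Ms

    Reach : V → V → Set
    Reach = Star HAdj

    data Alt : List V → Set where
      alt-end  : ∀ {a b} → InE a b Ms → Alt (a ∷ b ∷ [])
      alt-more : ∀ {a b c rest} → InE a b Ms → InE b c M →
                 Alt (c ∷ rest) → Alt (a ∷ b ∷ c ∷ rest)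

    IsEnd : V → List V → Set
    IsEnd w xs = head xs ≡ just w ⊎ last xs ≡ just w

    -- xs is the vertex sequence of an M-M*-path with m ≥ 1 edges of M
    -- (so at least 4 vertices), whose end nodes are not covered by M
    MPath : List V → Set
    MPath xs = Alt xs × Unique xs × 4 ≤ length xs ×
               (∀ e → IsEnd e xs → ¬ Covered M e)

    CompIs : V → List V → Set
    CompIs x xs = ∀ z → (Reach x z → z ∈ xs) × (z ∈ xs → Reach x z)

    ComponentStructure : Set
    ComponentStructure = ∀ x y → HAdj x y →
      (InE x y M × InE x y Ms × CompIs x (x ∷ y ∷ [])) ⊎
      (∃[ xs ] (MPath xs × CompIs x xs))

    Endpoint : V → Set
    Endpoint w = ∃[ xs ] (MPath xs × CompIs w xs × IsEnd w xs)

    InF : V → V → Set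
    InF v w = Adj v w × ¬ InE v w M × ¬ InE v w Ms

  -- {v , w} is a transfer w.r.t. the run ps (whose matching is M = ps)
  -- and M*:  v covered by M is deleted in step s = (a , b); the current
  -- degree of w at the end of step s is at most Δ - 2.
  Transfer : ℕ → List (V × V) → List (V × V) → V → V → Set
  Transfer Δ ps Ms v w =
    InF ps Ms v w × Covered ps v × Endpoint ps Ms w ×
    ∃[ pre ] ∃[ post ] ∃[ a ] ∃[ b ]
      (ps ≡ pre ++ (a , b) ∷ post × (v ≡ a ⊎ v ≡ b) ×
       curdeg ((a , b) ∷ post) w ≤ Δ ∸ 2)

-- The endpoint w is not covered by M, so by termination of the greedy algorithm every
-- neighbour y of w is deleted, in some step s(y).
--
-- d(w) ≥ 2: otherwise the only neighbour x of w is its successor on the path, and as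
-- long as x is present w has current degree 1, so every step deletes a node of current
-- degree ≤ 1. Walk along the path from w: at the step deleting an M-edge {q₁,q₂} of the
-- path, the chosen node has its two path neighbours, one of which (the far one, q₃) may
-- already be gone; then move on to the earlier step that deleted q₃. Since the far end
-- of the path is uncovered, some step deletes a node with two present neighbours.
--
-- Counting: a neighbour y of w yields a transfer unless it is the M*-partner of w or it
-- is late, i.e. d(w) > Δ - 2 at the end of s(y). There is at most one late neighbour,
-- because at the end of the later of two such steps w has lost both and has degree at
-- most Δ - 2. With no late neighbour c_w ≥ d_G(w) - 1; with a late y we get
-- Δ - 1 ≤ d(w) ≤ d_G(w) - 1 at the end of s(y), hence c_w ≥ d_G(w) - 2 ≥ Δ - 2.
module Submission where

open import Defs hiding (sym)
open import Data.Bool using (Bool; true; false; _∧_; _∨_; not; if_then_else_)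
open import Data.Bool.Properties using (∨-zeroʳ; ¬-not)
import Data.Bool as Bool
open import Data.Empty using (⊥; ⊥-elim)
open import Data.Fin using (Fin; _≟_)
import Data.Fin as F
open import Data.Fin.Properties using (0≢1+n; suc-injective; any?)
open import Data.List using (List; []; _∷_; _++_; _∷ʳ_; length; map; head; last; reverse)
open import Data.List.Properties
  using (length-map; ++-assoc; unfold-reverse; reverse-involutive; reverse-++)
open import Data.List.Relation.Binary.Permutation.Propositional using (↭-sym; ↭⇒↭ₛ)
open import Data.List.Relation.Binary.Permutation.Propositional.Properties using (↭-reverse)
import Data.List.Relation.Binary.Permutation.Setoid.Properties as PermutationSetoid
open import Data.List.Membership.Propositional using (_∈_)
open import Data.Product.Properties using (≡-dec)
import Data.List.Membership.DecPropositional as DecMembership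
open import Data.List.Membership.Propositional.Properties using (∈-++⁺ʳ; ∈-∃++)
open import Data.List.Relation.Unary.Any using (here; there)
open import Data.List.Relation.Unary.All using (All; []; _∷_; universal; tabulate; lookup)
import Data.List.Relation.Unary.All as All
import Data.List.Relation.Unary.All.Properties as AllP
open import Data.List.Relation.Unary.AllPairs using ([]; _∷_)
open import Data.List.Relation.Unary.Unique.Propositional using (Unique)
import Data.List.Relation.Unary.Unique.Propositional.Properties as Unique
import Data.Nat as ℕ
open import Data.Nat using (ℕ; suc; _+_; _≤_; _∸_; _⊓_; z≤n; s≤s; _≤?_)
open import Data.Nat.Properties
  using (≤-trans; ≤-reflexive; 1+n≰n; ≰⇒>; m≤n+m; +-comm; +-commutativeSemigroup;
         +-mono-≤; +-monoˡ-≤; +-monoʳ-≤; +-cancelˡ-≤; m+n≤o⇒m≤o∸n; m≤n+o⇒m∸n≤o;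
         ∸-monoˡ-≤; m⊓n≤m; m⊓n≤n; ⊓-glb; module ≤-Reasoning)
open import Algebra.Properties.CommutativeSemigroup +-commutativeSemigroup using (interchange)
open import Data.Maybe using (just)
open import Function using (_∘_)
open import Data.Product using (∃-syntax; _×_; _,_; proj₁; proj₂)
open import Data.Sum using (_⊎_; inj₁; inj₂)
import Data.Sum as Sum
open import Relation.Nullary using (¬_; Dec; yes; no; ¬?)
open import Relation.Nullary.Decidable using (⌊_⌋; _×-dec_; _⊎-dec_)
open import Relation.Binary.PropositionalEquality
  using (_≡_; _≢_; refl; sym; trans; cong; cong₂; subst; setoid; module ≡-Reasoning)

⌊⌋-true : ∀ {A : Set} (a? : Dec A) → A → ⌊ a? ⌋ ≡ true
⌊⌋-true (yes _) _ = refl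
⌊⌋-true (no ¬a) a = ⊥-elim (¬a a)

⌊⌋-false : ∀ {A : Set} (a? : Dec A) → ¬ A → ⌊ a? ⌋ ≡ false
⌊⌋-false (yes a) ¬a = ⊥-elim (¬a a)
⌊⌋-false (no _)  _  = refl

⌊⌋-true⁻ : ∀ {A : Set} (a? : Dec A) → ⌊ a? ⌋ ≡ true → A
⌊⌋-true⁻ (yes a) _ = a

∧-true : ∀ {a b} → a ≡ true → b ≡ true → a ∧ b ≡ true
∧-true refl refl = refl

bit : Bool → ℕ
bit b = if b then 1 else 0

countB-split : ∀ {n} (f p : Fin n → Bool) →
  countB f ≡ countB (λ i → f i ∧ p i) + countB (λ i → f i ∧ not (p i))
countB-split {ℕ.zero} f p = refl
countB-split {suc n} f p = begin
  bit (f F.zero) + countB (f ∘ F.suc)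
    ≡⟨ cong₂ _+_ (bit-split (f F.zero) (p F.zero)) (countB-split (f ∘ F.suc) (p ∘ F.suc)) ⟩
  (bit (f F.zero ∧ p F.zero) + bit (f F.zero ∧ not (p F.zero)))
    + (countB (λ i → f (F.suc i) ∧ p (F.suc i)) + countB (λ i → f (F.suc i) ∧ not (p (F.suc i))))
    ≡⟨ interchange (bit (f F.zero ∧ p F.zero)) (bit (f F.zero ∧ not (p F.zero)))
                   (countB (λ i → f (F.suc i) ∧ p (F.suc i)))
                   (countB (λ i → f (F.suc i) ∧ not (p (F.suc i)))) ⟩
  countB (λ i → f i ∧ p i) + countB (λ i → f i ∧ not (p i)) ∎
  where
  open ≡-Reasoning
  bit-split : ∀ a b → bit a ≡ bit (a ∧ b) + bit (a ∧ not b)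
  bit-split false _     = refl
  bit-split true  true  = refl
  bit-split true  false = refl

countB-∪ : ∀ {n} (f g h : Fin n → Bool) →
  (∀ i → f i ≡ true → g i ≡ true ⊎ h i ≡ true) → countB f ≤ countB g + countB h
countB-∪ {ℕ.zero} _ _ _ _ = z≤n
countB-∪ {suc n} f g h f⊆g∪h = begin
  bit (f F.zero) + countB (f ∘ F.suc)
    ≤⟨ +-mono-≤ (bit-∪ (f F.zero) (g F.zero) (h F.zero) (f⊆g∪h F.zero))
                (countB-∪ (f ∘ F.suc) (g ∘ F.suc) (h ∘ F.suc) (f⊆g∪h ∘ F.suc)) ⟩
  (bit (g F.zero) + bit (h F.zero)) + (countB (g ∘ F.suc) + countB (h ∘ F.suc))
    ≡⟨ interchange (bit (g F.zero)) (bit (h F.zero)) (countB (g ∘ F.suc)) (countB (h ∘ F.suc)) ⟩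
  countB g + countB h ∎
  where
  open ≤-Reasoning
  bit-∪ : ∀ a b c → (a ≡ true → b ≡ true ⊎ c ≡ true) → bit a ≤ bit b + bit c
  bit-∪ false _ _ _ = z≤n
  bit-∪ true b c a⊆b∪c with a⊆b∪c refl
  ... | inj₁ refl = s≤s z≤n
  ... | inj₂ refl = m≤n+m 1 (bit b)

countB≥1 : ∀ {n} (f : Fin n → Bool) i → f i ≡ true → 1 ≤ countB f
countB≥1 f F.zero fi rewrite fi = s≤s z≤n
countB≥1 f (F.suc i) fi = ≤-trans (countB≥1 (f ∘ F.suc) i fi) (m≤n+m _ (bit (f F.zero)))

-- Split off the indicator of i: then i and j are counted in different summands.
countB≥2 : ∀ {n} (f : Fin n → Bool) i j → f i ≡ true → f j ≡ true → i ≢ j → 2 ≤ countB f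
countB≥2 f i j fi fj i≢j = subst (2 ≤_) (sym (countB-split f (λ k → ⌊ k ≟ i ⌋)))
  (+-mono-≤ (countB≥1 _ i (∧-true fi (⌊⌋-true (i ≟ i) refl)))
            (countB≥1 _ j (∧-true fj (cong not (⌊⌋-false (j ≟ i) (λ j≡i → i≢j (sym j≡i)))))))

countB-none : ∀ {n} (f : Fin n → Bool) → (∀ i → f i ≢ true) → countB f ≡ 0
countB-none {ℕ.zero} f none = refl
countB-none {suc n} f none with f F.zero | none F.zero
... | true  | f0≢true = ⊥-elim (f0≢true refl)
... | false | _       = countB-none (f ∘ F.suc) (none ∘ F.suc)

countB≤1 : ∀ {n} (f : Fin n → Bool) → (∀ i j → f i ≡ true → f j ≡ true → i ≡ j) → countB f ≤ 1
countB≤1 {ℕ.zero} f unique = z≤n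
countB≤1 {suc n} f unique with f F.zero in f0
... | true  = s≤s (≤-reflexive (countB-none (f ∘ F.suc)
                  (λ i fi → 0≢1+n (unique F.zero (F.suc i) f0 fi))))
... | false = countB≤1 (f ∘ F.suc) (λ i j fi fj → suc-injective (unique (F.suc i) (F.suc j) fi fj))

trues : ∀ {n} → (Fin n → Bool) → List (Fin n)
trues {ℕ.zero}  f = []
trues {suc n} f = if f F.zero then F.zero ∷ rest else rest
  where rest = map F.suc (trues (f ∘ F.suc))

length-trues : ∀ {n} (f : Fin n → Bool) → length (trues f) ≡ countB f
length-trues {ℕ.zero} f = refl
length-trues {suc n} f with f F.zero
... | true  = cong suc length-rest
  where length-rest = trans (length-map F.suc (trues (f ∘ F.suc))) (length-trues (f ∘ F.suc))
... | false = trans (length-map F.suc (trues (f ∘ F.suc))) (length-trues (f ∘ F.suc))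

trues-sound : ∀ {n} (f : Fin n → Bool) → All (λ i → f i ≡ true) (trues f)
trues-sound {ℕ.zero} f = []
trues-sound {suc n} f with f F.zero in f0
... | true  = f0 ∷ AllP.map⁺ (trues-sound (f ∘ F.suc))
... | false = AllP.map⁺ (trues-sound (f ∘ F.suc))

trues-unique : ∀ {n} (f : Fin n → Bool) → Unique (trues f)
trues-unique {ℕ.zero} f = []
trues-unique {suc n} f with f F.zero
... | true  = AllP.map⁺ (universal (λ _ → 0≢1+n) _) ∷ unique-rest
  where unique-rest = Unique.map⁺ suc-injective (trues-unique (f ∘ F.suc))
... | false = Unique.map⁺ suc-injective (trues-unique (f ∘ F.suc))

Suffix : ∀ {A : Set} → List A → List A → Set
Suffix T L = ∃[ pre ] L ≡ pre ++ T

suffix-⊆ : ∀ {A : Set} {T L : List A} → Suffix T L → ∀ {e} → e ∈ T → e ∈ L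
suffix-⊆ (pre , refl) = ∈-++⁺ʳ pre

suffix-trans : ∀ {A : Set} {T P L : List A} → Suffix T P → Suffix P L → Suffix T L
suffix-trans {T = T} (pre , refl) (pre′ , refl) = pre′ ++ pre , sym (++-assoc pre′ pre T)

suffix-∷ : ∀ {A : Set} {e : A} {T L} → Suffix (e ∷ T) L → Suffix T L
suffix-∷ {e = e} {T} (pre , refl) = pre ++ e ∷ [] , sym (++-assoc pre (e ∷ []) T)

module _ {n : ℕ} (G : Graph n) where

  adj-sym : ∀ {a b} → Adj G a b → Adj G b a
  adj-sym {a} {b} ab = trans (Graph.sym G b a) ab

  adj⇒≢ : ∀ {a b} → Adj G a b → a ≢ b
  adj⇒≢ {a} aa refl with () ← trans (sym (irrefl G a)) aa

  inPairs⇒Covered : ∀ {L x} → inPairs G x L ≡ true → Covered G L x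
  inPairs⇒Covered {(a , b) ∷ L} {x} x∈ with x ≟ a | x ≟ b
  ... | yes refl | _        = b , inj₁ (here refl)
  ... | no _     | yes refl = a , inj₂ (here refl)
  ... | no _     | no _     with inPairs⇒Covered {L} x∈
  ...   | y , inj₁ m = y , inj₁ (there m)
  ...   | y , inj₂ m = y , inj₂ (there m)

  inPairs-∷ : ∀ {p L x} → inPairs G x L ≡ true → inPairs G x (p ∷ L) ≡ true
  inPairs-∷ x∈ = trans (cong (_ ∨_) x∈) (∨-zeroʳ _)

  Covered⇒inPairs : ∀ {L x} → Covered G L x → inPairs G x L ≡ true
  Covered⇒inPairs {(a , b) ∷ L} {x} (_ , inj₁ (here refl))
    rewrite ⌊⌋-true (x ≟ x) refl = refl
  Covered⇒inPairs {(a , b) ∷ L} {x} (_ , inj₂ (here refl))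
    rewrite ⌊⌋-true (x ≟ x) refl | ∨-zeroʳ ⌊ x ≟ a ⌋ = refl
  Covered⇒inPairs {_ ∷ L} {x} (y , inj₁ (there m)) =
    inPairs-∷ {L = L} {x} (Covered⇒inPairs (y , inj₁ m))
  Covered⇒inPairs {_ ∷ L} {x} (y , inj₂ (there m)) =
    inPairs-∷ {L = L} {x} (Covered⇒inPairs (y , inj₂ m))

  ¬Covered⇒inPairs≡false : ∀ {L x} → ¬ Covered G L x → inPairs G x L ≡ false
  ¬Covered⇒inPairs≡false ¬c = ¬-not (λ x∈ → ¬c (inPairs⇒Covered x∈))

  inPairs≡false⇒¬Covered : ∀ {L x} → inPairs G x L ≡ false → ¬ Covered G L x
  inPairs≡false⇒¬Covered x∉ c with () ← trans (sym x∉) (Covered⇒inPairs c)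

  inE-⊆ : ∀ {T L a b} → (∀ {e} → e ∈ T → e ∈ L) → InE G a b T → InE G a b L
  inE-⊆ T⊆L = Sum.map T⊆L T⊆L

  uncovered-suffix : ∀ {T L} x → Suffix T L → inPairs G x L ≡ false → inPairs G x T ≡ false
  uncovered-suffix {L = L} x sfx x∉L = ¬Covered⇒inPairs≡false λ (y , xy) →
    inPairs≡false⇒¬Covered {L} {x} x∉L (y , inE-⊆ (suffix-⊆ sfx) xy)

  Covered⇒∈endpoints : ∀ {L x} → Covered G L x → x ∈ endpointsOf G L
  Covered⇒∈endpoints {_ ∷ L} (_ , inj₁ (here refl)) = here refl
  Covered⇒∈endpoints {_ ∷ L} (_ , inj₂ (here refl)) = there (here refl)
  Covered⇒∈endpoints {_ ∷ L} (y , inj₁ (there m)) =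
    there (there (Covered⇒∈endpoints {L} (y , inj₁ m)))
  Covered⇒∈endpoints {_ ∷ L} (y , inj₂ (there m)) =
    there (there (Covered⇒∈endpoints {L} (y , inj₂ m)))

  ∈endpoints⇒Covered : ∀ {L x} → x ∈ endpointsOf G L → Covered G L x
  ∈endpoints⇒Covered {(a , b) ∷ L} (here refl)         = b , inj₁ (here refl)
  ∈endpoints⇒Covered {(a , b) ∷ L} (there (here refl)) = a , inj₂ (here refl)
  ∈endpoints⇒Covered {(a , b) ∷ L} (there (there m)) with ∈endpoints⇒Covered {L} m
  ... | y , inj₁ m′ = y , inj₁ (there m′)
  ... | y , inj₂ m′ = y , inj₂ (there m′)

  inE-∷ : ∀ {a b x y L} → InE G x y ((a , b) ∷ L) →
    (x , y) ≡ (a , b) ⊎ (x , y) ≡ (b , a) ⊎ InE G x y L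
  inE-∷ (inj₁ (here refl)) = inj₁ refl
  inE-∷ (inj₂ (here refl)) = inj₂ (inj₁ refl)
  inE-∷ (inj₁ (there m))   = inj₂ (inj₂ (inj₁ m))
  inE-∷ (inj₂ (there m))   = inj₂ (inj₂ (inj₂ m))

  matching-adj : ∀ {L a b} → IsMatching G L → InE G a b L → Adj G a b
  matching-adj (adjacent , _) (inj₁ ab∈) = lookup adjacent ab∈
  matching-adj (adjacent , _) (inj₂ ba∈) = adj-sym (lookup adjacent ba∈)

  partner-unique : ∀ {L x y z} → Unique (endpointsOf G L) → InE G x y L → InE G x z L → y ≡ z
  partner-unique {[]} _ (inj₁ ()) _
  partner-unique {[]} _ (inj₂ ()) _
  partner-unique {(a , b) ∷ L} (a∉ ∷ b∉ ∷ unique) xy xz with inE-∷ xy | inE-∷ xz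
  ... | inj₁ refl        | inj₁ refl        = refl
  ... | inj₂ (inj₁ refl) | inj₂ (inj₁ refl) = refl
  ... | inj₁ refl        | inj₂ (inj₁ refl) = ⊥-elim (All.head a∉ refl)
  ... | inj₂ (inj₁ refl) | inj₁ refl        = ⊥-elim (All.head a∉ refl)
  ... | inj₁ refl        | inj₂ (inj₂ xz′)  = ⊥-elim (lookup (All.tail a∉) (Covered⇒∈endpoints (_ , xz′)) refl)
  ... | inj₂ (inj₂ xy′)  | inj₁ refl        = ⊥-elim (lookup (All.tail a∉) (Covered⇒∈endpoints (_ , xy′)) refl)
  ... | inj₂ (inj₁ refl) | inj₂ (inj₂ xz′)  = ⊥-elim (lookup b∉ (Covered⇒∈endpoints (_ , xz′)) refl)
  ... | inj₂ (inj₂ xy′)  | inj₂ (inj₁ refl) = ⊥-elim (lookup b∉ (Covered⇒∈endpoints (_ , xy′)) refl)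
  ... | inj₂ (inj₂ xy′)  | inj₂ (inj₂ xz′)  = partner-unique unique xy′ xz′

  run-endpoints-unique : ∀ {L} → Run G L → Unique (endpointsOf G L)
  run-endpoints-unique done = []
  run-endpoints-unique (step {L} run u∉ v∉ uv _) =
    (adj⇒≢ uv ∷ fresh u∉) ∷ fresh v∉ ∷ run-endpoints-unique run
    where
    fresh : ∀ {x} → inPairs G x L ≡ false → All (x ≢_) (endpointsOf G L)
    fresh {x} x∉ =
      tabulate λ { m refl → inPairs≡false⇒¬Covered {L} {x} x∉ (∈endpoints⇒Covered {L} m) }

  run-suffix : ∀ {T L} → Run G L → Suffix T L → Run G T
  run-suffix run               ([] , refl)    = run
  run-suffix (step run _ _ _ _) (_ ∷ pre , refl) = run-suffix run (pre , refl)

  pair-inPairs : ∀ {L a b x} → (a , b) ∈ L → x ≡ a ⊎ x ≡ b → inPairs G x L ≡ true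
  pair-inPairs ab∈ (inj₁ refl) = Covered⇒inPairs (_ , inj₁ ab∈)
  pair-inPairs ab∈ (inj₂ refl) = Covered⇒inPairs (_ , inj₂ ab∈)

  -- (a , b) or (b , a) is a step of L, and T lists the steps before it.
  StepOf : Fin n → Fin n → List (Fin n × Fin n) → List (Fin n × Fin n) → Set
  StepOf a b T L = Suffix ((a , b) ∷ T) L ⊎ Suffix ((b , a) ∷ T) L

  inE⇒StepOf : ∀ {a b L} → InE G a b L → ∃[ T ] StepOf a b T L
  inE⇒StepOf (inj₁ m) with ∈-∃++ m
  ... | pre , T , eq = T , inj₁ (pre , eq)
  inE⇒StepOf (inj₂ m) with ∈-∃++ m
  ... | pre , T , eq = T , inj₂ (pre , eq)

  stepOf-weaken : ∀ {a b T P L} → Suffix P L → StepOf a b T P → StepOf a b T L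
  stepOf-weaken P⊑L = Sum.map (λ sfx → suffix-trans sfx P⊑L) (λ sfx → suffix-trans sfx P⊑L)

  stepOf-fresh : ∀ {a b T L} → Run G L → StepOf a b T L →
    inPairs G a T ≡ false × inPairs G b T ≡ false
  stepOf-fresh run (inj₁ sfx) with run-suffix run sfx
  ... | step _ a∉ b∉ _ _ = a∉ , b∉
  stepOf-fresh run (inj₂ sfx) with run-suffix run sfx
  ... | step _ b∉ a∉ _ _ = a∉ , b∉

  stepOf-suffix : ∀ {a b T L} → StepOf a b T L → Suffix T L
  stepOf-suffix = Sum.[ suffix-∷ , suffix-∷ ]

  stepOf-adj : ∀ {a b T L} → Run G L → StepOf a b T L → Adj G a b
  stepOf-adj run (inj₁ sfx) with run-suffix run sfx
  ... | step _ _ _ ab _ = ab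
  stepOf-adj run (inj₂ sfx) with run-suffix run sfx
  ... | step _ _ _ ba _ = adj-sym ba

  -- Runs list the newest step first, so this is the state at the end of the step deleting y.
  untilDeleting : Fin n → List (Fin n × Fin n) → List (Fin n × Fin n)
  untilDeleting y []            = []
  untilDeleting y ((a , b) ∷ L) = if ⌊ y ≟ a ⌋ ∨ ⌊ y ≟ b ⌋ then (a , b) ∷ L else untilDeleting y L

  untilDeleting-step : ∀ {L y} → inPairs G y L ≡ true →
    ∃[ pre ] ∃[ post ] ∃[ a ] ∃[ b ]
      (L ≡ pre ++ (a , b) ∷ post × (y ≡ a ⊎ y ≡ b) × untilDeleting y L ≡ (a , b) ∷ post)
  untilDeleting-step {(a , b) ∷ L} {y} y∈ with y ≟ a | y ≟ b
  ... | yes y≡a | _       = [] , L , a , b , refl , inj₁ y≡a , refl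
  ... | no _    | yes y≡b = [] , L , a , b , refl , inj₂ y≡b , refl
  ... | no _    | no _    with untilDeleting-step {L} y∈
  ...   | pre , post , a′ , b′ , refl , y∈a′b′ , until≡ =
          (a , b) ∷ pre , post , a′ , b′ , refl , y∈a′b′ , until≡

  untilDeleting-covers : ∀ {L y} → inPairs G y L ≡ true → inPairs G y (untilDeleting y L) ≡ true
  untilDeleting-covers {L} {y} y∈ with untilDeleting-step {L} {y} y∈
  ... | _ , post , a , b , _ , y∈ab , until≡ rewrite until≡ =
    pair-inPairs {(a , b) ∷ post} (here refl) y∈ab

  -- The later of the two deletions has removed both vertices.
  untilDeleting-later : ∀ {L i j} → inPairs G i L ≡ true → inPairs G j L ≡ true →
    (inPairs G i (untilDeleting i L) ≡ true × inPairs G j (untilDeleting i L) ≡ true) ⊎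
    (inPairs G i (untilDeleting j L) ≡ true × inPairs G j (untilDeleting j L) ≡ true)
  untilDeleting-later {(a , b) ∷ L} {i} {j} i∈ j∈ with i ≟ a | i ≟ b
  ... | yes i≡a | _       = inj₁ (pair-inPairs {(a , b) ∷ L} (here refl) (inj₁ i≡a) , j∈)
  ... | no _    | yes i≡b = inj₁ (pair-inPairs {(a , b) ∷ L} (here refl) (inj₂ i≡b) , j∈)
  ... | no _    | no _    with j ≟ a | j ≟ b
  ...   | yes j≡a | _       =
    inj₂ (inPairs-∷ {L = L} {i} i∈ , pair-inPairs {(a , b) ∷ L} (here refl) (inj₁ j≡a))
  ...   | no _    | yes j≡b =
    inj₂ (inPairs-∷ {L = L} {i} i∈ , pair-inPairs {(a , b) ∷ L} (here refl) (inj₂ j≡b))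
  ...   | no _    | no _    = untilDeleting-later {L} i∈ j∈

  deg-split : ∀ S x → countB (λ y → adj G x y ∧ inPairs G y S) + curdeg G S x ≡ deg G x
  deg-split S x = sym (countB-split (adj G x) (λ y → inPairs G y S))

  curdeg≤deg : ∀ S x → curdeg G S x ≤ deg G x
  curdeg≤deg S x = subst (curdeg G S x ≤_) (deg-split S x) (m≤n+m _ _)

  1≤curdeg : ∀ S {x} y → Adj G x y → inPairs G y S ≡ false → 1 ≤ curdeg G S x
  1≤curdeg S y xy y∉ = countB≥1 _ y (∧-true xy (cong not y∉))

  2≤curdeg : ∀ S {x y z} → Adj G x y → Adj G x z → inPairs G y S ≡ false → inPairs G z S ≡ false →
    y ≢ z → 2 ≤ curdeg G S x
  2≤curdeg S {y = y} {z} xy xz y∉ z∉ =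
    countB≥2 _ y z (∧-true xy (cong not y∉)) (∧-true xz (cong not z∉))

  1+curdeg≤deg : ∀ S {x} y → Adj G x y → inPairs G y S ≡ true → 1 + curdeg G S x ≤ deg G x
  1+curdeg≤deg S {x} y xy y∈ = subst (1 + curdeg G S x ≤_) (deg-split S x)
    (+-monoˡ-≤ (curdeg G S x) (countB≥1 _ y (∧-true xy y∈)))

  2+curdeg≤deg : ∀ S {x y z} → Adj G x y → Adj G x z → inPairs G y S ≡ true → inPairs G z S ≡ true →
    y ≢ z → 2 + curdeg G S x ≤ deg G x
  2+curdeg≤deg S {x} {y} {z} xy xz y∈ z∈ y≢z = subst (2 + curdeg G S x ≤_) (deg-split S x)
    (+-monoˡ-≤ (curdeg G S x) (countB≥2 _ y z (∧-true xy y∈) (∧-true xz z∈) y≢z))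

last-∷ʳ : ∀ {A : Set} (xs : List A) x → last (xs ∷ʳ x) ≡ just x
last-∷ʳ []           x = refl
last-∷ʳ (_ ∷ [])     x = refl
last-∷ʳ (_ ∷ y ∷ xs) x = last-∷ʳ (y ∷ xs) x

last-reverse : ∀ {A : Set} (xs : List A) → last (reverse xs) ≡ head xs
last-reverse []       = refl
last-reverse (x ∷ xs) = trans (cong last (unfold-reverse x xs)) (last-∷ʳ (reverse xs) x)

head-reverse : ∀ {A : Set} (xs : List A) → head (reverse xs) ≡ last xs
head-reverse xs = trans (sym (last-reverse (reverse xs))) (cong last (reverse-involutive xs))

Unique-reverse : ∀ {A : Set} {xs : List A} → Unique xs → Unique (reverse xs)
Unique-reverse {A} {xs} = PermutationSetoid.Unique-resp-↭ (setoid A) (↭⇒↭ₛ (↭-sym (↭-reverse xs)))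

module _ {n : ℕ} (G : Graph n) (M Ms : List (Fin n × Fin n)) where

  Alt-∷ʳ : ∀ {ys a b c} → Alt G M Ms ys → last ys ≡ just c → InE G c b M → InE G b a Ms →
    Alt G M Ms (ys ++ b ∷ a ∷ [])
  Alt-∷ʳ (alt-end e)         refl cb ba = alt-more e cb (alt-end ba)
  Alt-∷ʳ (alt-more e f alt) last≡ cb ba = alt-more e f (Alt-∷ʳ alt last≡ cb ba)

  Alt-reverse : ∀ {ys} → Alt G M Ms ys → Alt G M Ms (reverse ys)
  Alt-reverse (alt-end e) = alt-end (Sum.swap e)
  Alt-reverse (alt-more {a} {b} {c} {rest} ab bc alt) =
    subst (Alt G M Ms) (sym (reverse-++ (a ∷ b ∷ []) (c ∷ rest)))
      (Alt-∷ʳ (Alt-reverse alt) (last-reverse (c ∷ rest)) (Sum.swap bc) (Sum.swap ab))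

  MPath-from : ∀ {xs w} → MPath G M Ms xs → IsEnd G M Ms w xs →
    ∃[ ys ] (Alt G M Ms ys × Unique ys × head ys ≡ just w ×
             (∀ e → last ys ≡ just e → ¬ Covered G M e))
  MPath-from {xs} (alt , unique , _ , ends) (inj₁ head≡) =
    xs , alt , unique , head≡ , λ e last≡ → ends e (inj₂ last≡)
  MPath-from {xs} (alt , unique , _ , ends) (inj₂ last≡) =
    reverse xs , Alt-reverse alt , Unique-reverse unique , trans (head-reverse xs) last≡ ,
    λ e last≡′ → ends e (inj₁ (trans (sym (last-reverse xs)) last≡′))

module LowDegreeEndpoint {n : ℕ} (G : Graph n) {ps Ms : List (Fin n × Fin n)} (run : Run G ps)
  (Ms-matching : IsMatching G Ms) {w x : Fin n} (w∼x : Adj G w x) (w∉ : inPairs G w ps ≡ false)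
  (deg≤1 : deg G w ≤ 1) where

  lonely : ∀ {c d P y z} → Suffix ((c , d) ∷ P) ps → inPairs G x P ≡ false →
    Adj G c y → Adj G c z → inPairs G y P ≡ false → inPairs G z P ≡ false → y ≢ z → ⊥
  lonely {c} {P = P} sfx x∉ c∼y c∼z y∉ z∉ y≢z with run-suffix G run sfx
  ... | step _ _ _ _ minimal = 1+n≰n (begin
    2               ≤⟨ 2≤curdeg G P c∼y c∼z y∉ z∉ y≢z ⟩
    curdeg G P c    ≤⟨ minimal w w∉P (1≤curdeg G P x w∼x x∉) ⟩
    curdeg G P w    ≤⟨ curdeg≤deg G P w ⟩
    deg G w         ≤⟨ deg≤1 ⟩
    1               ∎)
    where
    open ≤-Reasoning
    w∉P : inPairs G w P ≡ false
    w∉P = uncovered-suffix G w (suffix-∷ sfx) w∉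

  -- Walking along the path, each M-edge met is deleted strictly before the previous one.
  descent : ∀ {prev q₁ q₂ rest T} → Alt G ps Ms (q₂ ∷ rest) → Unique (prev ∷ q₁ ∷ q₂ ∷ rest) →
    (∀ e → last (q₂ ∷ rest) ≡ just e → inPairs G e ps ≡ false) → Adj G prev q₁ →
    StepOf G q₁ q₂ T ps → inPairs G prev T ≡ false → inPairs G x T ≡ false → ⊥
  descent _ ((_ ∷ prev≢q₂ ∷ _) ∷ _) _ prev∼q₁ del@(inj₁ sfx) prev∉T x∉T =
    lonely sfx x∉T (adj-sym G prev∼q₁) (stepOf-adj G run del) prev∉T
      (proj₂ (stepOf-fresh G run del)) prev≢q₂
  descent (alt-end {b = q₃} q₂∼q₃) (_ ∷ (_ ∷ q₁≢q₃ ∷ _) ∷ _) ends _ del@(inj₂ sfx) _ x∉T =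
    lonely sfx x∉T (adj-sym G (stepOf-adj G run del)) (matching-adj G Ms-matching q₂∼q₃)
      (proj₁ (stepOf-fresh G run del)) (uncovered-suffix G q₃ (stepOf-suffix G del) (ends q₃ refl))
      q₁≢q₃
  descent {q₂ = q₂} {T = T} (alt-more {b = q₃} q₂∼q₃ q₃q₄ alt) (_ ∷ (_ ∷ q₁≢q₃ ∷ _) ∷ unique) ends _
          del@(inj₂ sfx) _ x∉T with inPairs G q₃ T in q₃∈T
  ... | false =
    lonely sfx x∉T (adj-sym G (stepOf-adj G run del)) (matching-adj G Ms-matching q₂∼q₃)
      (proj₁ (stepOf-fresh G run del)) q₃∈T q₁≢q₃
  ... | true with inPairs⇒Covered G {T} {q₃} q₃∈T
  ...   | y , q₃y with partner-unique G (run-endpoints-unique G run)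
                       (inE-⊆ G (suffix-⊆ (stepOf-suffix G del)) q₃y) q₃q₄
  ...     | refl with inE⇒StepOf G q₃y
  ...       | T′ , del′ =
    descent alt unique ends (matching-adj G Ms-matching q₂∼q₃)
      (stepOf-weaken G (stepOf-suffix G del) del′)
      (uncovered-suffix G q₂ (stepOf-suffix G del′) (proj₂ (stepOf-fresh G run del)))
      (uncovered-suffix G x (stepOf-suffix G del′) x∉T)

no-degree-one-end : ∀ {n} (G : Graph n) {ps Ms ys w} → Greedy G ps → IsMatching G Ms →
  Alt G ps Ms ys → Unique ys → head ys ≡ just w → (∀ e → last ys ≡ just e → ¬ Covered G ps e) →
  ¬ Covered G ps w → deg G w ≤ 1 → ⊥
no-degree-one-end G (_ , maximal) Ms-matching (alt-end {b = x} w∼x) _ refl ends w-uncovered _ =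
  maximal _ x (¬Covered⇒inPairs≡false G w-uncovered) (¬Covered⇒inPairs≡false G (ends x refl))
    (matching-adj G Ms-matching w∼x)
no-degree-one-end G {ps} {w = w} (run , _) Ms-matching (alt-more {b = x} {p} {r} w∼x xp alt)
                  unique refl ends w-uncovered deg≤1 with inE⇒StepOf G xp
... | T , del = descent alt unique ends′ w∼x′ del
    (uncovered-suffix G w (stepOf-suffix G del) w∉) (proj₁ (stepOf-fresh G run del))
  where
  w∼x′ : Adj G w x
  w∼x′ = matching-adj G Ms-matching w∼x
  w∉ : inPairs G w ps ≡ false
  w∉ = ¬Covered⇒inPairs≡false G {ps} {w} w-uncovered
  ends′ : ∀ e → last (p ∷ r) ≡ just e → inPairs G e ps ≡ false
  ends′ e last≡ = ¬Covered⇒inPairs≡false G {ps} {e} (ends e last≡)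
  open LowDegreeEndpoint G run Ms-matching w∼x′ w∉ deg≤1

module Transfers {n : ℕ} (G : Graph n) (Δ : ℕ) (deg≤Δ : ∀ x → deg G x ≤ Δ)
  {ps Ms : List (Fin n × Fin n)} (greedy : Greedy G ps) (Ms-matching : IsMatching G Ms)
  {w : Fin n} (endpoint : Endpoint G ps Ms w) (w-uncovered : ¬ Covered G ps w) where

  neighbour-covered : ∀ {y} → Adj G w y → inPairs G y ps ≡ true
  neighbour-covered {y} w∼y with inPairs G y ps in y∈
  ... | true  = refl
  ... | false = ⊥-elim (proj₂ greedy w y (¬Covered⇒inPairs≡false G {ps} {w} w-uncovered) y∈ w∼y)

  Good : Fin n → Set
  Good y = curdeg G (untilDeleting G y ps) w ≤ Δ ∸ 2

  Candidate Partner Late : Fin n → Set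
  Candidate y = Adj G w y × ¬ InE G w y Ms × Good y
  Partner   y = Adj G w y × InE G w y Ms
  Late      y = Adj G w y × ¬ Good y

  adj? : ∀ y → Dec (Adj G w y)
  adj? y = adj G w y Bool.≟ true

  inMs? : ∀ y → Dec (InE G w y Ms)
  inMs? y = ((w , y) ∈? Ms) ⊎-dec ((y , w) ∈? Ms)
    where open DecMembership (≡-dec (_≟_ {n}) _≟_) using (_∈?_)

  good? : ∀ y → Dec (Good y)
  good? y = _ ≤? _

  candidate? : ∀ y → Dec (Candidate y)
  candidate? y = adj? y ×-dec ¬? (inMs? y) ×-dec good? y

  partner? : ∀ y → Dec (Partner y)
  partner? y = adj? y ×-dec inMs? y

  late? : ∀ y → Dec (Late y)
  late? y = adj? y ×-dec ¬? (good? y)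

  partnerOrLate? : ∀ y → Dec (Partner y ⊎ Late y)
  partnerOrLate? y = partner? y ⊎-dec late? y

  #_ : ∀ {P : Fin n → Set} → (∀ y → Dec (P y)) → ℕ
  # P? = countB (λ y → ⌊ P? y ⌋)

  classify : ∀ {y} → Adj G w y → Candidate y ⊎ Partner y ⊎ Late y
  classify {y} w∼y with inMs? y | good? y
  ... | yes inMs | _         = inj₂ (inj₁ (w∼y , inMs))
  ... | no ¬inMs | yes good  = inj₁ (w∼y , ¬inMs , good)
  ... | no _     | no ¬good  = inj₂ (inj₂ (w∼y , ¬good))

  deg≤partners+late+candidates : deg G w ≤ (# partner? + # late?) + # candidate?
  deg≤partners+late+candidates = ≤-trans
    (countB-∪ (adj G w) (λ y → ⌊ partnerOrLate? y ⌋) (λ y → ⌊ candidate? y ⌋) λ y w∼y →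
      Sum.[ (λ c → inj₂ (⌊⌋-true (candidate? y) c))
          , (λ pl → inj₁ (⌊⌋-true (partnerOrLate? y) pl)) ]′ (classify w∼y))
    (+-monoˡ-≤ (# candidate?)
      (countB-∪ _ _ _ λ y pl → Sum.map (⌊⌋-true (partner? y)) (⌊⌋-true (late? y))
                                (⌊⌋-true⁻ (partnerOrLate? y) pl)))

  partners≤1 : # partner? ≤ 1
  partners≤1 = countB≤1 _ λ i j pi pj →
    partner-unique G (proj₂ Ms-matching) (proj₂ (⌊⌋-true⁻ (partner? i) pi))
                                         (proj₂ (⌊⌋-true⁻ (partner? j) pj))

  good-if-two-deleted : ∀ S {i j} → Adj G w i → Adj G w j → i ≢ j →
    inPairs G i S ≡ true → inPairs G j S ≡ true → curdeg G S w ≤ Δ ∸ 2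
  good-if-two-deleted S w∼i w∼j i≢j i∈ j∈ = m+n≤o⇒m≤o∸n (curdeg G S w)
    (subst (_≤ Δ) (+-comm 2 (curdeg G S w))
      (≤-trans (2+curdeg≤deg G S w∼i w∼j i∈ j∈ i≢j) (deg≤Δ w)))

  late-unique : ∀ {i j} → Late i → Late j → i ≡ j
  late-unique {i} {j} (w∼i , ¬good-i) (w∼j , ¬good-j) with i ≟ j
  ... | yes i≡j = i≡j
  ... | no i≢j
    with untilDeleting-later G {ps} {i} {j} (neighbour-covered w∼i) (neighbour-covered w∼j)
  ... | inj₁ (i∈ , j∈) =
    ⊥-elim (¬good-i (good-if-two-deleted (untilDeleting G i ps) w∼i w∼j i≢j i∈ j∈))
  ... | inj₂ (i∈ , j∈) =
    ⊥-elim (¬good-j (good-if-two-deleted (untilDeleting G j ps) w∼i w∼j i≢j i∈ j∈))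

  candidate⇒Transfer : ∀ {v} → Candidate v → Transfer G Δ ps Ms v w
  candidate⇒Transfer {v} (w∼v , ¬inMs , good)
    with untilDeleting-step G {ps} {v} (neighbour-covered w∼v)
  ... | pre , post , a , b , ps≡ , v∈ab , until≡ =
    (adj-sym G w∼v , (λ vw → w-uncovered (v , Sum.swap vw)) , (λ vw → ¬inMs (Sum.swap vw))) ,
    inPairs⇒Covered G (neighbour-covered w∼v) , endpoint ,
    pre , post , a , b , ps≡ , v∈ab , subst (λ S → curdeg G S w ≤ Δ ∸ 2) until≡ good

  late≤1 : # late? ≤ 1
  late≤1 = countB≤1 _ λ i j li lj → late-unique (⌊⌋-true⁻ (late? i) li) (⌊⌋-true⁻ (late? j) lj)

  transfers≥ : (deg G w ∸ 1) ⊓ (Δ ∸ 2) ≤ # candidate?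
  transfers≥ with any? late?
  ... | yes (y , w∼y , ¬good) = ≤-trans (m⊓n≤n _ _) (+-cancelˡ-≤ 2 _ _ (begin
    2 + (Δ ∸ 2)                         ≤⟨ +-monoʳ-≤ 1 (≰⇒> ¬good) ⟩
    1 + curdeg G S w                    ≤⟨ 1+curdeg≤deg G S y w∼y y∈S ⟩
    deg G w                             ≤⟨ deg≤partners+late+candidates ⟩
    (# partner? + # late?) + # candidate? ≤⟨ +-monoˡ-≤ _ (+-mono-≤ partners≤1 late≤1) ⟩
    2 + # candidate?                    ∎))
    where
    open ≤-Reasoning
    S = untilDeleting G y ps
    y∈S : inPairs G y S ≡ true
    y∈S = untilDeleting-covers G {ps} {y} (neighbour-covered w∼y)
  ... | no no-late = ≤-trans (m⊓n≤m _ _) (m≤n+o⇒m∸n≤o (deg G w) 1 (begin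
    deg G w                             ≤⟨ deg≤partners+late+candidates ⟩
    (# partner? + # late?) + # candidate?
      ≤⟨ +-monoˡ-≤ _ (+-mono-≤ partners≤1 (≤-reflexive no-late′)) ⟩
    (1 + 0) + # candidate?              ∎))
    where
    open ≤-Reasoning
    no-late′ : # late? ≡ 0
    no-late′ = countB-none _ λ y l → no-late (y , ⌊⌋-true⁻ (late? y) l)

  transfers : ∃[ L ] (Unique L × All (λ v → Transfer G Δ ps Ms v w) L ×
                      (deg G w ∸ 1) ⊓ (Δ ∸ 2) ≤ length L)
  transfers = trues isCandidate , trues-unique isCandidate ,
    All.map (λ {v} c → candidate⇒Transfer (⌊⌋-true⁻ (candidate? v) c)) (trues-sound isCandidate) ,
    subst (_ ≤_) (sym (length-trues isCandidate)) transfers≥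
    where
    isCandidate : Fin n → Bool
    isCandidate y = ⌊ candidate? y ⌋

lemma2 : (Δ : ℕ) → 3 ≤ Δ → (n : ℕ) → (G : Graph n) →
    (∀ x → deg G x ≤ Δ) →
    (ps : List (Fin n × Fin n)) → Greedy G ps →
    (Ms : List (Fin n × Fin n)) → IsMaxMatching G Ms →
    ComponentStructure G ps Ms →
    (w : Fin n) → Endpoint G ps Ms w →
    (1 ≤ (deg G w ∸ 1) ⊓ (Δ ∸ 2)) ×
    (∃[ L ] (Unique L × All (λ v → Transfer G Δ ps Ms v w) L ×
             (deg G w ∸ 1) ⊓ (Δ ∸ 2) ≤ length L))
lemma2 Δ 3≤Δ n G deg≤Δ ps greedy Ms (Ms-matching , _) _ w endpoint@(_ , path , _ , w-end) =
  ⊓-glb (∸-monoˡ-≤ 1 2≤deg) (∸-monoˡ-≤ 2 3≤Δ) , transfers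
  where
  w-uncovered : ¬ Covered G ps w
  w-uncovered = proj₂ (proj₂ (proj₂ path)) w w-end

  2≤deg : 2 ≤ deg G w
  2≤deg with MPath-from G ps Ms path w-end
  ... | _ , alt , unique , head≡ , ends =
    ≰⇒> (no-degree-one-end G greedy Ms-matching alt unique head≡ ends w-uncovered)

  open Transfers G Δ deg≤Δ greedy Ms-matching endpoint w-uncovered
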